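{- Work intuitionistically. Let $X$ be a locale. 1. If $X$ is discrete (i.e. $\Omega X$ is the power set of some set), then $X$ is an o-algebra. 2. If $X$ is overt and Boolean, then $X$ is an o-algebra. 3. Assuming classical logic, if $X$ is an o-algebra, then $X$ is (overt and) Boolean.
   Context: A locale $X$ is given by its frame $\Omega X$. $\Omega$ is the frame of truth values (power set of a singleton), and $\Omega!_X:\Omega\to\Omega X$ is $\Omega!_X(p)=\bigvee\{x\in\Omega X\mid x=1\text{ and }p=1\}$. $X$ is overt if $\Omega!_X$ has a left adjoint $\mathrm{Pos}_X:\Omega X\to\Omega$ (i.e. $\mathrm{Pos}_X(x)\le p$ iff $x\le\Omega!_X(p)$). An overlap algebra (o-algebra) is an overt locale $X$ such that for all $x,y\in\Omega X$: if $\mathrm{Pos}_X(z\wedge x)\le\mathrm{Pos}_X(z\wedge y)$ for all $z\in\Omega X$, then $x\le y$. $X$ is Boolean if $x\vee -x=1$ for all $x\in\Omega X$. -}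

module Defs where

open import Level using (Level; _⊔_; Lift; lift; lower) renaming (suc to lsuc)
open import Data.Product using (Σ; _×_; _,_; proj₁; proj₂)
open import Data.Sum using (_⊎_; inj₁; inj₂)
open import Data.Empty using (⊥; ⊥-elim)
open import Data.Unit using (tt) renaming (⊤ to Unit)
open import Data.Bool using (Bool; true; false)
open import Relation.Nullary using (¬_)

-- Equality of opens is mutual ≤ (no quotients in Agda).
-- Since we work predicatively, the pseudocomplement (which is definable
-- impredicatively as a join) is included as data, characterised by its
-- universal property  z ∧ x ≤ 0  ⇔  z ≤ - x.
record Frame (c ℓ ι : Level) : Set (lsuc (c ⊔ ℓ ⊔ ι)) where
  infix 4 _≤_
  infixr 7 _∧_
  field
    Carrier : Set c
    _≤_     : Carrier → Carrier → Set ℓ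
    ≤-refl  : ∀ {x} → x ≤ x
    ≤-trans : ∀ {x y z} → x ≤ y → y ≤ z → x ≤ z
    ⊤       : Carrier
    ⊤-max   : ∀ {x} → x ≤ ⊤
    _∧_     : Carrier → Carrier → Carrier
    ∧-≤ˡ    : ∀ {x y} → x ∧ y ≤ x
    ∧-≤ʳ    : ∀ {x y} → x ∧ y ≤ y
    ∧-glb   : ∀ {x y z} → z ≤ x → z ≤ y → z ≤ x ∧ y
    ⋁       : {I : Set ι} → (I → Carrier) → Carrier
    ⋁-ub    : ∀ {I : Set ι} (f : I → Carrier) (i : I) → f i ≤ ⋁ f
    ⋁-lub   : ∀ {I : Set ι} (f : I → Carrier) {z} → (∀ i → f i ≤ z) → ⋁ f ≤ z
    distrib : ∀ x {I : Set ι} (f : I → Carrier) → x ∧ ⋁ f ≤ ⋁ (λ i → x ∧ f i)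
    -_      : Carrier → Carrier
    -‿elim  : ∀ {x} → (- x) ∧ x ≤ ⋁ {Lift ι ⊥} (λ i → ⊥-elim (lower i))
    -‿intro : ∀ {x z} → z ∧ x ≤ ⋁ {Lift ι ⊥} (λ i → ⊥-elim (lower i)) → z ≤ - x

  𝟘 : Carrier
  𝟘 = ⋁ {Lift ι ⊥} (λ i → ⊥-elim (lower i))

  _∨_ : Carrier → Carrier → Carrier
  x ∨ y = ⋁ {Lift ι Bool} (λ { (lift true) → x ; (lift false) → y })

  _≈_ : Carrier → Carrier → Set ℓ
  x ≈ y = (x ≤ y) × (y ≤ x)

𝒫 : ∀ {ι} (S : Set ι) → Frame (lsuc ι) ι ι
𝒫 {ι} S = record
  { Carrier = S → Set ι
  ; _≤_     = λ A B → ∀ s → A s → B s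
  ; ≤-refl  = λ s a → a
  ; ≤-trans = λ p q s a → q s (p s a)
  ; ⊤       = λ _ → Lift ι Unit
  ; ⊤-max   = λ s _ → lift tt
  ; _∧_     = λ A B s → A s × B s
  ; ∧-≤ˡ    = λ s ab → proj₁ ab
  ; ∧-≤ʳ    = λ s ab → proj₂ ab
  ; ∧-glb   = λ p q s c → p s c , q s c
  ; ⋁       = λ {I} f s → Σ I (λ i → f i s)
  ; ⋁-ub    = λ f i s a → i , a
  ; ⋁-lub   = λ f h s ia → h (proj₁ ia) s (proj₂ ia)
  ; distrib = λ x f s p → proj₁ (proj₂ p) , (proj₁ p , proj₂ (proj₂ p))
  ; -_      = λ A s → ¬ A s
  ; -‿elim  = λ s p → ⊥-elim (proj₁ p (proj₂ p))
  ; -‿intro = λ h s z a → ⊥-elim (lower (proj₁ (h s (z , a))))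
  }

Ω : ∀ ι → Frame (lsuc ι) ι ι
Ω ι = 𝒫 (Lift ι Unit)

module _ {c ℓ ι : Level} (X : Frame c ℓ ι) where
  private module X = Frame X
  private module Ω' = Frame (Ω ι)

  -- Ω!_X(p) = ⋁ { x ∈ ΩX | x = 1 and p = 1 }  (the join of the family
  -- constantly 1, indexed by the proof-set of p).
  Ω! : Ω'.Carrier → X.Carrier
  Ω! p = X.⋁ {p (lift tt)} (λ _ → X.⊤)

  Overt : Set (lsuc ι ⊔ c ⊔ ℓ)
  Overt = Σ (X.Carrier → Ω'.Carrier) λ Pos →
            ∀ (x : X.Carrier) (p : Ω'.Carrier) →
              ((Pos x Ω'.≤ p) → (x X.≤ Ω! p)) × ((x X.≤ Ω! p) → (Pos x Ω'.≤ p))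

  OAlgebra : Set (lsuc ι ⊔ c ⊔ ℓ)
  OAlgebra = Σ Overt λ ov → let Pos = proj₁ ov in
               ∀ (x y : X.Carrier) →
                 (∀ (z : X.Carrier) → Pos (z X.∧ x) Ω'.≤ Pos (z X.∧ y)) →
                 x X.≤ y

  Boolean : Set (c ⊔ ℓ)
  Boolean = ∀ (x : X.Carrier) → (X.⊤ X.≤ (x X.∨ (X.- x))) × ((x X.∨ (X.- x)) X.≤ X.⊤)

record OrderIso {c ℓ ι c' ℓ' ι'} (X : Frame c ℓ ι) (Y : Frame c' ℓ' ι')
       : Set (c ⊔ ℓ ⊔ c' ⊔ ℓ') where
  private module X = Frame X
  private module Y = Frame Y
  field
    to       : X.Carrier → Y.Carrier
    from     : Y.Carrier → X.Carrier
    to-mono  : ∀ {x x'} → x X.≤ x' → to x Y.≤ to x'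
    from-mono : ∀ {y y'} → y Y.≤ y' → from y X.≤ from y'
    from-to  : ∀ x → from (to x) X.≈ x
    to-from  : ∀ y → to (from y) Y.≈ y

Discrete : ∀ {c ℓ ι} → Frame c ℓ ι → Set (lsuc ι ⊔ c ⊔ ℓ)
Discrete {ι = ι} X = Σ (Set ι) λ S → OrderIso X (𝒫 S)

LEM : (a : Level) → Set (lsuc a)
LEM a = (P : Set a) → P ⊎ ¬ P

-- Positivity detects emptiness: Pos x fails exactly when x ≤ 0. In a Boolean
-- frame x ≤ y follows from -y ∧ x ≤ 0, and testing the o-algebra hypothesis at
-- z = -y gives exactly that. Conversely, classically every z either meets x
-- positively or lies below -x, so z and z ∧ (x ∨ -x) are positive together and
-- the o-algebra axiom yields 1 ≤ x ∨ -x. For a power set, Pos x says that x is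
-- inhabited, and testing at the singleton {s} recovers membership of s.
module Submission where

open import Defs
open import Level using (Level; _⊔_; Lift; lift; lower)
open import Data.Product using (_×_; Σ; _,_; proj₁; proj₂)
open import Data.Sum using (inj₁; inj₂)
open import Data.Empty using (⊥; ⊥-elim)
open import Data.Unit using (tt)
open import Data.Bool using (true; false)
open import Relation.Nullary using (¬_)
open import Relation.Binary.PropositionalEquality using (_≡_; refl; sym; subst)

∅ : ∀ {ι} → Frame.Carrier (Ω ι)
∅ {ι} _ = Lift ι ⊥

LEM-lower : ∀ a b → LEM (a ⊔ b) → LEM a
LEM-lower a b lem P with lem (Lift b P)
... | inj₁ p  = inj₁ (lower p)
... | inj₂ ¬p = inj₂ (λ p → ¬p (lift p))

module FrameProperties {c ℓ ι : Level} (X : Frame c ℓ ι) where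
  open Frame X

  𝟘-min : ∀ {x} → 𝟘 ≤ x
  𝟘-min = ⋁-lub _ (λ i → ⊥-elim (lower i))

  x≤x∨y : ∀ {x y} → x ≤ x ∨ y
  x≤x∨y = ⋁-ub _ (lift true)

  y≤x∨y : ∀ {x y} → y ≤ x ∨ y
  y≤x∨y = ⋁-ub _ (lift false)

  ∧-monoʳ : ∀ {z y y'} → y ≤ y' → z ∧ y ≤ z ∧ y'
  ∧-monoʳ y≤y' = ∧-glb ∧-≤ˡ (≤-trans ∧-≤ʳ y≤y')

  ∧-comm : ∀ {x y} → x ∧ y ≤ y ∧ x
  ∧-comm = ∧-glb ∧-≤ʳ ∧-≤ˡ

  Ω!-∅≤𝟘 : Ω! X ∅ ≤ 𝟘
  Ω!-∅≤𝟘 = ⋁-lub _ (λ i → ⊥-elim (lower i))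

  ≤-of-complement : ∀ {x y} → ⊤ ≤ y ∨ (- y) → (- y) ∧ x ≤ 𝟘 → x ≤ y
  ≤-of-complement {x} {y} ⊤≤y∨-y -y∧x≤𝟘 =
    ≤-trans (∧-glb ≤-refl (≤-trans ⊤-max ⊤≤y∨-y))
      (≤-trans (distrib x _)
        (⋁-lub _ λ { (lift true)  → ∧-≤ʳ
                   ; (lift false) → ≤-trans ∧-comm (≤-trans -y∧x≤𝟘 𝟘-min) }))

module OvertProperties {c ℓ ι : Level} {X : Frame c ℓ ι} (overt : Overt X) where
  open Frame X
  open FrameProperties X
  private module Ω' = Frame (Ω ι)

  Pos : Carrier → Ω'.Carrier
  Pos = proj₁ overt

  Pos≤⇒≤Ω! : ∀ {x p} → Pos x Ω'.≤ p → x ≤ Ω! X p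
  Pos≤⇒≤Ω! = proj₁ (proj₂ overt _ _)

  ≤Ω!⇒Pos≤ : ∀ {x p} → x ≤ Ω! X p → Pos x Ω'.≤ p
  ≤Ω!⇒Pos≤ = proj₂ (proj₂ overt _ _)

  Pos-mono : ∀ {x y} → x ≤ y → Pos x Ω'.≤ Pos y
  Pos-mono x≤y = ≤Ω!⇒Pos≤ (≤-trans x≤y (Pos≤⇒≤Ω! Ω'.≤-refl))

  ¬Pos-𝟘 : ¬ Pos 𝟘 (lift tt)
  ¬Pos-𝟘 p = lower (≤Ω!⇒Pos≤ 𝟘-min (lift tt) p)

  ¬Pos⇒≤𝟘 : ∀ {x} → ¬ Pos x (lift tt) → x ≤ 𝟘
  ¬Pos⇒≤𝟘 ¬p = ≤-trans (Pos≤⇒≤Ω! (λ { (lift tt) p → ⊥-elim (¬p p) })) Ω!-∅≤𝟘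

module OrderIsoProperties {c ℓ c' ℓ' ι : Level} {X : Frame c ℓ ι} {Y : Frame c' ℓ' ι}
                          (iso : OrderIso X Y) where
  private
    module X = Frame X
    module Y = Frame Y
  open OrderIso iso

  to-reflects : ∀ {x y} → to x Y.≤ to y → x X.≤ y
  to-reflects {x} {y} le =
    X.≤-trans (proj₂ (from-to x)) (X.≤-trans (from-mono le) (proj₁ (from-to y)))

  ⊤≤to-⊤ : Y.⊤ Y.≤ to X.⊤
  ⊤≤to-⊤ = Y.≤-trans (proj₂ (to-from Y.⊤)) (to-mono X.⊤-max)

  to-∧≥ : ∀ {a b} → to a Y.∧ to b Y.≤ to (a X.∧ b)
  to-∧≥ {a} {b} = Y.≤-trans (proj₂ (to-from _)) (to-mono (X.∧-glb
    (X.≤-trans (from-mono Y.∧-≤ˡ) (proj₁ (from-to a)))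
    (X.≤-trans (from-mono Y.∧-≤ʳ) (proj₁ (from-to b)))))

  to-⋁≤ : ∀ {I : Set ι} (f : I → X.Carrier) → to (X.⋁ f) Y.≤ Y.⋁ (λ i → to (f i))
  to-⋁≤ f = Y.≤-trans (to-mono (X.⋁-lub f λ i →
                X.≤-trans (proj₂ (from-to (f i))) (from-mono (Y.⋁-ub _ i))))
              (proj₁ (to-from _))

Boolean⇒OAlgebra : ∀ {c ℓ ι} (X : Frame c ℓ ι) → Overt X → Boolean X → OAlgebra X
Boolean⇒OAlgebra X overt boolean = overt , λ x y test →
  ≤-of-complement (proj₁ (boolean y))
    (¬Pos⇒≤𝟘 λ p → ¬Pos-𝟘 (Pos-mono -‿elim _ (test (- y) _ p)))
  where
  open Frame X
  open FrameProperties X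
  open OvertProperties {X = X} overt

OAlgebra⇒Boolean : ∀ {c ℓ ι} (X : Frame c ℓ ι) → LEM ι → OAlgebra X → Boolean X
OAlgebra⇒Boolean {ι = ι} X lem (overt , separates) x =
  separates ⊤ (x ∨ (- x)) positive-on-x∨-x , ⊤-max
  where
  open Frame X
  open FrameProperties X
  open OvertProperties {X = X} overt
  module Ω' = Frame (Ω ι)

  positive-on-x∨-x : ∀ z → Pos (z ∧ ⊤) Ω'.≤ Pos (z ∧ (x ∨ (- x)))
  positive-on-x∨-x z (lift tt) z-pos with lem (Pos (z ∧ x) (lift tt))
  ... | inj₁ z∧x-pos = Pos-mono (∧-monoʳ x≤x∨y) _ z∧x-pos
  ... | inj₂ z∧x-null =
    Pos-mono (∧-glb ∧-≤ˡ (≤-trans ∧-≤ˡ (≤-trans (-‿intro (¬Pos⇒≤𝟘 z∧x-null)) y≤x∨y))) _ z-pos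

module DiscreteProperties {c ℓ ι : Level} {X : Frame c ℓ ι} (S : Set ι)
                          (iso : OrderIso X (𝒫 S)) where
  open Frame X
  open OrderIso iso
  open OrderIsoProperties iso
  private module Ω' = Frame (Ω ι)

  Inhabited : Carrier → Ω'.Carrier
  Inhabited x _ = Σ S (to x)

  point : S → Carrier
  point s = from (s ≡_)

  ∈-point : ∀ s → to (point s) s
  ∈-point s = proj₂ (to-from (s ≡_)) s refl

  ∈-point⇒≡ : ∀ {s s'} → to (point s) s' → s ≡ s'
  ∈-point⇒≡ {s} {s'} = proj₁ (to-from (s ≡_)) s'

  discrete-Overt : Overt X
  discrete-Overt = Inhabited , λ x p →
      (λ inh⊆p → to-reflects λ s s∈x →
         to-mono (⋁-ub (λ _ → ⊤) (inh⊆p (lift tt) (s , s∈x))) s (⊤≤to-⊤ s (lift tt)))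
    , (λ { x≤Ω!p (lift tt) (s , s∈x) → proj₁ (to-⋁≤ (λ _ → ⊤) s (to-mono x≤Ω!p s s∈x)) })

  discrete-OAlgebra : OAlgebra X
  discrete-OAlgebra = discrete-Overt , λ x y test → to-reflects λ s s∈x →
    let (s' , s'∈point∧y) = test (point s) (lift tt) (s , to-∧≥ s (∈-point s , s∈x))
    in subst (to y) (sym (∈-point⇒≡ (to-mono ∧-≤ˡ s' s'∈point∧y))) (to-mono ∧-≤ʳ s' s'∈point∧y)

proposition3p3 : ∀ {c ℓ ι : Level} (X : Frame c ℓ ι) →
    (Discrete X → OAlgebra X)
    × (Overt X → Boolean X → OAlgebra X)
    × (LEM (c ⊔ ℓ ⊔ ι) → OAlgebra X → Overt X × Boolean X)
proposition3p3 {c} {ℓ} {ι} X =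
    (λ (S , iso) → DiscreteProperties.discrete-OAlgebra {X = X} S iso)
  , Boolean⇒OAlgebra X
  , λ lem oalgebra →
      proj₁ oalgebra , OAlgebra⇒Boolean X (LEM-lower ι (c ⊔ ℓ) lem) oalgebra
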